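{- Let $L:\mathcal U$ be a $\mathcal V$-sup-lattice with a basis $\beta:B\to L$ that is $\mathcal V$-presented and locally $\mathcal V$-small, and let $f:L\to L$ be a monotone map. If $f$ is dense, then $f$ is bounded, i.e. there exists a bounded generator $\phi:\mathcal P_{\mathcal U\sqcup\mathcal V^+}(B\times L)$ with $\Gamma_\phi(x)=f(x)$ for all $x:L$.
   Context: We work in Martin-Löf type theory with non-cumulative universes $\mathcal U,\mathcal V,\mathcal W,\dots$ (successor $\mathcal V^+$, join $\sqcup$), function extensionality, propositional extensionality and propositional truncations ($\exists$ is truncated $\Sigma$), without propositional resizing. A type is $\mathcal V$-small if equivalent to a type in $\mathcal V$; locally $\mathcal V$-small if all its identity types are $\mathcal V$-small. $\mathcal P_{\mathcal T}(X):=X\to\Omega_{\mathcal T}$, with $x\in S$, $\subseteq$, $\mathbb T(S):=\sum_{x:X}x\in S$. A poset is a type $P:\mathcal U$ with a proposition-valued reflexive, antisymmetric, transitive relation $\le:P\to P\to\mathcal W$. A $\mathcal V$-sup-lattice is a poset $L:\mathcal U$ in which every family indexed by a type in $\mathcal V$ has a join $\bigvee$. A basis is $B:\mathcal V$ with $\beta:B\to L$ such that (1) each $\beta(b)\le x$ is $\mathcal V$-small (write $b\le^B x$ for a chosen equivalent type in $\mathcal V$) and (2) each $x:L$ is the join of $\beta\circ\mathrm{pr}_1$ on $\downarrow^B x:=\sum_{b:B}\beta(b)\le x$. For $X:\mathcal P_{\mathcal V}(B)$, $\bigvee X$ is the join of $\beta\circ\mathrm{pr}_1:\mathbb T(X)\to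 L$. $L$ is $\mathcal V$-presented if there are $J:\mathcal V$, $Y:J\to\mathcal P_{\mathcal V}(B)$, $R:\mathcal P_{\mathcal V}(B\times\mathcal P_{\mathcal V}(B))$ such that for all $b:B$, $X:\mathcal P_{\mathcal V}(B)$: $b\le^B\bigvee X\iff\exists j:J,\ Y(j)\subseteq X\wedge(b,Y(j))\in R$. A generator is $\phi:\mathcal P_{\mathcal U\sqcup\mathcal V^+}(B\times L)$; $S_{\phi,a}:=\sum_{b:B}\exists a':L,(b,a')\in\phi\wedge a'\le a$; if each $S_{\phi,a}$ is $\mathcal V$-small ($\phi$ local), $\Gamma_\phi(a):=\bigvee S_{\phi,a}$ (join of $\beta\circ\mathrm{pr}_1$). $\phi$ is bounded if each $(b,a)\in\phi$ is $\mathcal V$-small and there are $I:\mathcal V$, $\alpha:I\to\mathcal V$ such that whenever $(b,a)\in\phi$ there merely exist $i:I$ and a surjection $\alpha(i)\twoheadrightarrow\downarrow^B a$. A monotone $f:L\to L$ is dense if there is $\gamma:D\to L$ with $D:\mathcal V$ such that for all $b:B$, $a:L$: $b\le^B f(a)\to\exists v:D,\ b\le^B f(\gamma(v))\wedge\gamma(v)\le a$. -}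

{-# OPTIONS --without-K #-}
module Defs where

open import Level using (Level; _⊔_; suc; Setω)
open import Data.Product using (Σ; Σ-syntax; _×_; _,_; proj₁; proj₂)
open import Relation.Binary.PropositionalEquality using (_≡_)
open import Function.Bundles using (_↔_; Inverse)

-- Ambient univalent-foundations assumptions (as in TypeTopology, they are
-- passed as explicit hypotheses rather than postulated).

isProp : ∀ {ℓ} → Set ℓ → Set ℓ
isProp A = (x y : A) → x ≡ y

record PropTrunc : Setω where
  field
    ∥_∥      : ∀ {ℓ} → Set ℓ → Set ℓ
    ∥∥-isProp : ∀ {ℓ} {A : Set ℓ} → isProp ∥ A ∥
    ∣_∣      : ∀ {ℓ} {A : Set ℓ} → A → ∥ A ∥
    ∥∥-rec   : ∀ {ℓ ℓ'} {A : Set ℓ} {P : Set ℓ'} → isProp P → (A → P) → ∥ A ∥ → P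

FunExt : Setω
FunExt = ∀ {a b} {A : Set a} {B : A → Set b} {f g : (x : A) → B x}
       → ((x : A) → f x ≡ g x) → f ≡ g

PropExt : Setω
PropExt = ∀ {ℓ} {P Q : Set ℓ} → isProp P → isProp Q → (P → Q) → (Q → P) → P ≡ Q

is-small : ∀ {a} (𝓥 : Level) → Set a → Set (suc 𝓥 ⊔ a)
is-small 𝓥 A = Σ[ A' ∈ Set 𝓥 ] (A' ↔ A)

locally-small : ∀ {a} (𝓥 : Level) → Set a → Set (suc 𝓥 ⊔ a)
locally-small 𝓥 A = (x y : A) → is-small 𝓥 (x ≡ y)

Ω : (ℓ : Level) → Set (suc ℓ)
Ω ℓ = Σ[ P ∈ Set ℓ ] isProp P

𝓟 : ∀ {a} (ℓ : Level) → Set a → Set (a ⊔ suc ℓ)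
𝓟 ℓ X = X → Ω ℓ

_∈_ : ∀ {a ℓ} {X : Set a} → X → 𝓟 ℓ X → Set ℓ
x ∈ S = proj₁ (S x)

_⊆_ : ∀ {a ℓ ℓ'} {X : Set a} → 𝓟 ℓ X → 𝓟 ℓ' X → Set (a ⊔ ℓ ⊔ ℓ')
S ⊆ T = ∀ x → x ∈ S → x ∈ T

𝕋 : ∀ {a ℓ} {X : Set a} → 𝓟 ℓ X → Set (a ⊔ ℓ)
𝕋 {X = X} S = Σ[ x ∈ X ] x ∈ S

record Poset (𝓤 𝓦 : Level) : Set (suc (𝓤 ⊔ 𝓦)) where
  field
    carrier    : Set 𝓤
    _≤_        : carrier → carrier → Set 𝓦
    ≤-isProp   : ∀ x y → isProp (x ≤ y)
    ≤-refl     : ∀ x → x ≤ x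
    ≤-antisym  : ∀ {x y} → x ≤ y → y ≤ x → x ≡ y
    ≤-trans    : ∀ {x y z} → x ≤ y → y ≤ z → x ≤ z

is-upper-bound : ∀ {𝓤 𝓦 i} (P : Poset 𝓤 𝓦) {I : Set i}
               → (I → Poset.carrier P) → Poset.carrier P → Set (𝓦 ⊔ i)
is-upper-bound P {I} α x = (j : I) → Poset._≤_ P (α j) x

is-lub : ∀ {𝓤 𝓦 i} (P : Poset 𝓤 𝓦) {I : Set i}
       → (I → Poset.carrier P) → Poset.carrier P → Set (𝓤 ⊔ 𝓦 ⊔ i)
is-lub P α x = is-upper-bound P α x
             × ((y : Poset.carrier P) → is-upper-bound P α y → Poset._≤_ P x y)

record SupLattice (𝓥 𝓤 𝓦 : Level) : Set (suc (𝓥 ⊔ 𝓤 ⊔ 𝓦)) where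
  field
    poset    : Poset 𝓤 𝓦
  open Poset poset public
  field
    ⋁        : {I : Set 𝓥} → (I → carrier) → carrier
    ⋁-is-lub : {I : Set 𝓥} (α : I → carrier) → is-lub poset α (⋁ α)

record Basis {𝓥 𝓤 𝓦 : Level} (L : SupLattice 𝓥 𝓤 𝓦) : Set (suc 𝓥 ⊔ 𝓤 ⊔ 𝓦) where
  open SupLattice L
  field
    B      : Set 𝓥
    β      : B → carrier
    _≤ᴮ_   : B → carrier → Set 𝓥
    ≤ᴮ-≃   : ∀ b x → (b ≤ᴮ x) ↔ (β b ≤ x)
    ↓-is-lub : ∀ x → is-lub poset (λ (p : Σ[ b ∈ B ] (b ≤ᴮ x)) → β (proj₁ p)) x

module WithPT (pt : PropTrunc) {𝓥 𝓤 𝓦 : Level}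
              (L : SupLattice 𝓥 𝓤 𝓦) (𝓑 : Basis L) where
  open PropTrunc pt
  open SupLattice L
  open Basis 𝓑

  ∃ : ∀ {a b} {A : Set a} → (A → Set b) → Set (a ⊔ b)
  ∃ {A = A} P = ∥ Σ A P ∥

  _↠_ : ∀ {a b} → Set a → Set b → Set (a ⊔ b)
  A ↠ T = Σ[ g ∈ (A → T) ] ((t : T) → ∥ Σ[ x ∈ A ] (g x ≡ t) ∥)

  ↓ᴮ : carrier → Set (𝓥 ⊔ 𝓦)
  ↓ᴮ x = Σ[ b ∈ B ] (β b ≤ x)

  ⋁ᴮ : 𝓟 𝓥 B → carrier
  ⋁ᴮ X = ⋁ (λ (p : 𝕋 X) → β (proj₁ p))

  is-presented : Set (suc 𝓥)
  is-presented =
    Σ[ J ∈ Set 𝓥 ] Σ[ Y ∈ (J → 𝓟 𝓥 B) ] Σ[ R ∈ 𝓟 𝓥 (B × 𝓟 𝓥 B) ]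
      ((b : B) (X : 𝓟 𝓥 B) →
        ((b ≤ᴮ ⋁ᴮ X) → ∃ (λ (j : J) → (Y j ⊆ X) × ((b , Y j) ∈ R)))
      × (∃ (λ (j : J) → (Y j ⊆ X) × ((b , Y j) ∈ R)) → (b ≤ᴮ ⋁ᴮ X)))

  Generator : Set (suc (suc 𝓥 ⊔ 𝓤))
  Generator = 𝓟 (𝓤 ⊔ suc 𝓥) (B × carrier)

  S : Generator → carrier → Set (𝓤 ⊔ suc 𝓥 ⊔ 𝓦)
  S φ a = Σ[ b ∈ B ] ∃ (λ (a' : carrier) → ((b , a') ∈ φ) × (a' ≤ a))

  is-local : Generator → Set (suc 𝓥 ⊔ 𝓤 ⊔ 𝓦)
  is-local φ = (a : carrier) → is-small 𝓥 (S φ a)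

  -- Γ_φ(a) := ⋁ S_{φ,a}, the join of β ∘ pr₁ over the small copy of S_{φ,a}
  Γ : (φ : Generator) → is-local φ → carrier → carrier
  Γ φ loc a = ⋁ (λ (s : proj₁ (loc a)) → β (proj₁ (Inverse.to (proj₂ (loc a)) s)))

  is-bounded-generator : Generator → Set (suc 𝓥 ⊔ 𝓤 ⊔ 𝓦)
  is-bounded-generator φ =
      ((b : B) (a : carrier) → is-small 𝓥 ((b , a) ∈ φ))
    × (Σ[ I ∈ Set 𝓥 ] Σ[ α ∈ (I → Set 𝓥) ]
        ((b : B) (a : carrier) → (b , a) ∈ φ → ∃ (λ (i : I) → α i ↠ ↓ᴮ a)))

  is-monotone : (carrier → carrier) → Set (𝓤 ⊔ 𝓦)
  is-monotone f = ∀ x y → x ≤ y → f x ≤ f y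

  is-dense : (carrier → carrier) → Set (suc 𝓥 ⊔ 𝓤 ⊔ 𝓦)
  is-dense f = Σ[ D ∈ Set 𝓥 ] Σ[ γ ∈ (D → carrier) ]
    ((b : B) (a : carrier) → b ≤ᴮ f a
      → ∃ (λ (v : D) → (b ≤ᴮ f (γ v)) × (γ v ≤ a)))

  -- f is bounded: there is a bounded (hence, here, also local) generator φ
  -- with Γ_φ = f pointwise
  is-bounded-map : (carrier → carrier) → Set (suc (suc 𝓥 ⊔ 𝓤) ⊔ 𝓦)
  is-bounded-map f = Σ[ φ ∈ Generator ] is-bounded-generator φ
    × (Σ[ loc ∈ is-local φ ] ((x : carrier) → Γ φ loc x ≡ f x))

-- The generator φ := {(b , γ v) | β b ≤ f (γ v)} built from the density data
-- γ : D → L does the job.  By density every b below f a is already below some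
-- f (γ v) with γ v ≤ a, and by monotonicity conversely, so S_{φ,a} is the
-- small type ↓ᴮ (f a) and Γ_φ a = ⋁ ↓ᴮ (f a) = f a.  The second components of
-- φ all lie in the image of γ, and the down-set of γ v is covered by its small
-- copy Σ b, b ≤ᴮ γ v, which gives boundedness with index type D.  Local
-- smallness of L is what makes membership in the image of γ a small
-- proposition.
module Submission where

open import Defs
open import Level using (Level; Lift; lift; _⊔_)
open import Data.Product using (Σ-syntax; _×_; _,_; proj₁; proj₂)
open import Relation.Binary.PropositionalEquality using (_≡_; refl; sym; cong; cong₂; module ≡-Reasoning)
open import Function.Bundles using (_↔_; Inverse; mk↔ₛ′)

×-isProp : ∀ {p q} {P : Set p} {Q : Set q} → isProp P → isProp Q → isProp (P × Q)
×-isProp isProp-P isProp-Q (p , q) (p′ , q′) = cong₂ _,_ (isProp-P p p′) (isProp-Q q q′)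

Lift-isProp : ∀ {a} ℓ {A : Set a} → isProp A → isProp (Lift ℓ A)
Lift-isProp ℓ isProp-A (lift x) (lift y) = cong lift (isProp-A x y)

isProp-↔ : ∀ {a b} {A : Set a} {B : Set b}
         → isProp A → isProp B → (A → B) → (B → A) → A ↔ B
isProp-↔ isProp-A isProp-B to from =
  mk↔ₛ′ to from (λ _ → isProp-B _ _) (λ _ → isProp-A _ _)

↔-isProp : ∀ {a b} {A : Set a} {B : Set b} → A ↔ B → isProp B → isProp A
↔-isProp A↔B isProp-B x y = begin
  x                      ≡⟨ sym (Inverse.strictlyInverseʳ A↔B x) ⟩
  from (to x)            ≡⟨ cong from (isProp-B (to x) (to y)) ⟩
  from (to y)            ≡⟨ Inverse.strictlyInverseʳ A↔B y ⟩
  y                      ∎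
  where
  open ≡-Reasoning
  open Inverse A↔B using (to; from)

module Truncation (pt : PropTrunc) where
  open PropTrunc pt

  ∥∥-map : ∀ {a b} {A : Set a} {B : Set b} → (A → B) → ∥ A ∥ → ∥ B ∥
  ∥∥-map g = ∥∥-rec ∥∥-isProp (λ x → ∣ g x ∣)

  image-is-small : ∀ {𝓥 x} {D : Set 𝓥} {X : Set x}
                 → locally-small 𝓥 X → (γ : D → X) (a : X)
                 → is-small 𝓥 ∥ Σ[ v ∈ D ] (γ v ≡ a) ∥
  image-is-small ls γ a =
      ∥ Σ[ v ∈ _ ] proj₁ (ls (γ v) a) ∥
    , isProp-↔ ∥∥-isProp ∥∥-isProp
        (∥∥-map λ { (v , e) → v , Inverse.to (proj₂ (ls (γ v) a)) e })
        (∥∥-map λ { (v , e) → v , Inverse.from (proj₂ (ls (γ v) a)) e })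

module BasisProperties (pt : PropTrunc) {𝓥 𝓤 𝓦 : Level}
                       (L : SupLattice 𝓥 𝓤 𝓦) (𝓑 : Basis L) where
  open SupLattice L
  open Basis 𝓑
  open WithPT pt L 𝓑
  open PropTrunc pt

  ≤ᴮ⇒≤ : ∀ {b x} → b ≤ᴮ x → β b ≤ x
  ≤ᴮ⇒≤ {b} {x} = Inverse.to (≤ᴮ-≃ b x)

  ≤⇒≤ᴮ : ∀ {b x} → β b ≤ x → b ≤ᴮ x
  ≤⇒≤ᴮ {b} {x} = Inverse.from (≤ᴮ-≃ b x)

  ≤ᴮ-isProp : ∀ b x → isProp (b ≤ᴮ x)
  ≤ᴮ-isProp b x = ↔-isProp (≤ᴮ-≃ b x) (≤-isProp (β b) x)

  ⋁-↓ᴮ : ∀ x → ⋁ (λ (p : Σ[ b ∈ B ] (b ≤ᴮ x)) → β (proj₁ p)) ≡ x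
  ⋁-↓ᴮ x = ≤-antisym
    (proj₂ (⋁-is-lub family) x (proj₁ (↓-is-lub x)))
    (proj₂ (↓-is-lub x) (⋁ family) (proj₁ (⋁-is-lub family)))
    where
    family : Σ[ b ∈ B ] (b ≤ᴮ x) → carrier
    family p = β (proj₁ p)

  small-↓ᴮ-↠-↓ᴮ : ∀ x → (Σ[ b ∈ B ] (b ≤ᴮ x)) ↠ ↓ᴮ x
  small-↓ᴮ-↠-↓ᴮ x =
      (λ { (b , p) → b , ≤ᴮ⇒≤ p })
    , λ { (b , q) → ∣ (b , ≤⇒≤ᴮ q) , cong (b ,_) (≤-isProp _ _ _ _) ∣ }

module DenseIsBounded (pt : PropTrunc) {𝓥 𝓤 𝓦 : Level}
                      (L : SupLattice 𝓥 𝓤 𝓦) (𝓑 : Basis L)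
                      (ls : locally-small 𝓥 (SupLattice.carrier L))
                      (f : SupLattice.carrier L → SupLattice.carrier L)
                      (f-monotone : WithPT.is-monotone pt L 𝓑 f)
                      (f-dense : WithPT.is-dense pt L 𝓑 f) where
  open PropTrunc pt
  open SupLattice L
  open Basis 𝓑
  open WithPT pt L 𝓑
  open Truncation pt
  open BasisProperties pt L 𝓑

  D : Set 𝓥
  D = proj₁ f-dense

  γ : D → carrier
  γ = proj₁ (proj₂ f-dense)

  in-image-γ : carrier → Set (𝓥 ⊔ 𝓤)
  in-image-γ a = ∥ Σ[ v ∈ D ] (γ v ≡ a) ∥

  dense-generator-membership : B → carrier → Set (𝓥 ⊔ 𝓤)
  dense-generator-membership b a = (b ≤ᴮ f a) × in-image-γ a

  dense-generator-membership-isProp : ∀ b a → isProp (dense-generator-membership b a)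
  dense-generator-membership-isProp b a = ×-isProp (≤ᴮ-isProp b (f a)) ∥∥-isProp

  φ : Generator
  φ (b , a) = Lift (𝓤 ⊔ Level.suc 𝓥) (dense-generator-membership b a)
            , Lift-isProp _ (dense-generator-membership-isProp b a)

  φ-membership-is-small : ∀ b a → is-small 𝓥 ((b , a) ∈ φ)
  φ-membership-is-small b a =
      ((b ≤ᴮ f a) × proj₁ (image-is-small ls γ a))
    , isProp-↔ (×-isProp (≤ᴮ-isProp b (f a))
                         (↔-isProp (proj₂ (image-is-small ls γ a)) ∥∥-isProp))
               (Lift-isProp _ (dense-generator-membership-isProp b a))
               (λ { (p , q) → lift (p , Inverse.to (proj₂ (image-is-small ls γ a)) q) })
               (λ { (lift (p , q)) → p , Inverse.from (proj₂ (image-is-small ls γ a)) q })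

  φ-is-bounded : is-bounded-generator φ
  φ-is-bounded = φ-membership-is-small , D , (λ v → Σ[ b ∈ B ] (b ≤ᴮ γ v)) , covers
    where
    covers : ∀ b a → (b , a) ∈ φ → ∃ (λ v → (Σ[ b′ ∈ B ] (b′ ≤ᴮ γ v)) ↠ ↓ᴮ a)
    covers b a (lift (_ , a-in-image)) =
      ∥∥-map (λ { (v , refl) → v , small-↓ᴮ-↠-↓ᴮ (γ v) }) a-in-image

  S-φ-↔-↓ᴮ-f : ∀ a → (Σ[ b ∈ B ] (b ≤ᴮ f a)) ↔ S φ a
  S-φ-↔-↓ᴮ-f a = mk↔ₛ′ to from
    (λ { (b , _) → cong (b ,_) (∥∥-isProp _ _) })
    (λ { (b , _) → cong (b ,_) (≤ᴮ-isProp _ _ _ _) })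
    where
    to : Σ[ b ∈ B ] (b ≤ᴮ f a) → S φ a
    to (b , b≤fa) = b , ∥∥-map
      (λ { (v , b≤fγv , γv≤a) → γ v , lift (b≤fγv , ∣ v , refl ∣) , γv≤a })
      (proj₂ (proj₂ f-dense) b a b≤fa)
    from : S φ a → Σ[ b ∈ B ] (b ≤ᴮ f a)
    from (b , witness) = b , ∥∥-rec (≤ᴮ-isProp b (f a))
      (λ { (a′ , lift (b≤fa′ , _) , a′≤a) → ≤⇒≤ᴮ (≤-trans (≤ᴮ⇒≤ b≤fa′) (f-monotone a′ a a′≤a)) })
      witness

  φ-is-local : is-local φ
  φ-is-local a = (Σ[ b ∈ B ] (b ≤ᴮ f a)) , S-φ-↔-↓ᴮ-f a

  -- The to-map of S-φ-↔-↓ᴮ-f keeps first components, so Γ φ φ-is-local x is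
  -- literally the join of ↓ᴮ (f x).
  Γ-φ≡f : ∀ x → Γ φ φ-is-local x ≡ f x
  Γ-φ≡f x = ⋁-↓ᴮ (f x)

  f-is-bounded : is-bounded-map f
  f-is-bounded = φ , φ-is-bounded , φ-is-local , Γ-φ≡f

proposition10p7 : (pt : PropTrunc) → FunExt → PropExt → {𝓥 𝓤 𝓦 : Level} (L : SupLattice 𝓥 𝓤 𝓦) (𝓑 : Basis L) → WithPT.is-presented pt L 𝓑 → locally-small 𝓥 (SupLattice.carrier L) → (f : SupLattice.carrier L → SupLattice.carrier L) → WithPT.is-monotone pt L 𝓑 f → WithPT.is-dense pt L 𝓑 f → WithPT.is-bounded-map pt L 𝓑 f
proposition10p7 pt _ _ L 𝓑 _ ls f f-monotone f-dense =
  DenseIsBounded.f-is-bounded pt L 𝓑 ls f f-monotone f-dense
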